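{- Let $d\geq 2$ and $k\ge 0$ be integers and let $\underline{e}=(e_1,\ldots,e_{d-2})$ be a tuple of $2$-element subsets with $e_1\cup\cdots\cup e_{d-2}=[k]$. For $n'\ge k$ let $\gamma(n')\in\mathbb{Z}_{\ge0}^{\binom{[n']}{2}}$ with $\gamma(n')_e=|\{i:e_i=e\}|$, and $A^{(n')}=Q_{\gamma(n')}$ (defined below). Then the sequence $(A^{(n')})_{n'\geq k}$ satisfies: (i) $A^{(n')}\in\mathbb{R}^{\binom{[n']}{2}\times\binom{[n']}{2}}$ is symmetric for each $n'\ge k$; (ii) for all $k\le n''\le n'$ and all $e,f\in\binom{[n'']}{2}$, $A^{(n'')}_{e,f}=A^{(n')}_{e,f}$; (iii) for each $n'\ge k$ and every permutation $\sigma$ of $[n']$ fixing each element of $[k]$, $A^{(n')}_{\sigma\cdot e,\sigma\cdot f}=A^{(n')}_{e,f}$ for all $e,f\in\binom{[n']}{2}$, where $\sigma\cdot\{i,j\}=\{\sigma(i),\sigma(j)\}$.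
   Context: For $n'\ge 2$, $E'=\binom{[n']}{2}$, and $\alpha\in\mathbb{Z}_{\ge 0}^{E'}$ with $\sum_e\alpha_e=d$, define $b_\alpha=\sum\prod_{i=1}^d\frac{1}{|f_1\cup\cdots\cup f_i|}$, the sum over all $(f_1,\ldots,f_d)\in E'^d$ such that for each $e\in E'$ exactly $\alpha_e$ indices $i$ have $f_i=e$. For $\gamma\in\mathbb{Z}_{\ge0}^{E'}$ with $\sum_e\gamma_e=d-2$, with $v_e$ the standard basis vectors of $\mathbb{R}^{E'}$, define $Q_\gamma\in\mathbb{R}^{E'\times E'}$ by $(Q_\gamma)_{i,j}=(\gamma_i+1)(\gamma_j+1)\,b_{\gamma+v_i+v_j}$ for $i\neq j$ and $(Q_\gamma)_{i,i}=(\gamma_i+1)(\gamma_i+2)\,b_{\gamma+2v_i}$. -}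

module Defs where

open import Data.Nat as ℕ using (ℕ; zero; suc; _≤_; _∸_)
open import Data.Fin as Fin using (Fin; inject≤)
open import Data.Fin.Properties using (_≟_)
open import Data.Fin.Permutation using (Permutation′; _⟨$⟩ʳ_)
import Data.Bool
open import Data.Bool using (Bool; true; false; if_then_else_; _∧_; _∨_)
open import Data.List using (List; []; _∷_; concatMap; map; filter; foldr; length)
open import Data.List using (allFin)
open import Data.Nat.ListAction using () renaming (sum to sumℕ)
open import Data.Product using (_×_; _,_; proj₁; proj₂)
open import Data.Integer using (+_)
open import Data.Rational as ℚ using (ℚ; 0ℚ; 1ℚ; _/_)
open import Relation.Nullary using (¬_; does)
open import Relation.Binary.PropositionalEquality using (_≡_)

-- A "pair" of vertices of [n] = {0,…,n-1} (vertices are Fin n).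
-- A 2-element subset {i,j} of [n] is represented canonically by the
-- ordered pair (i , j) with i < j.
Pair : ℕ → Set
Pair n = Fin n × Fin n

IsEdge : ∀ {n} → Pair n → Set
IsEdge (i , j) = i Fin.< j

_==ᴾ_ : ∀ {n} → Pair n → Pair n → Bool
(i , j) ==ᴾ (i' , j') = does (i ≟ i') ∧ does (j ≟ j')

edges : (n : ℕ) → List (Pair n)
edges n = concatMap (λ i → map (λ j → (i , j)) (filter (λ j → i Fin.<? j) (allFin n))) (allFin n)

sumℚ : List ℚ → ℚ
sumℚ = foldr ℚ._+_ 0ℚ

-- 1/m as a rational (m = 0 never occurs below; it is mapped to 0)
inv : ℕ → ℚ
inv zero = 0ℚ
inv (suc m) = (+ 1) / suc m

nℚ : ℕ → ℚ
nℚ m = (+ m) / 1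

seqs : ∀ {A : Set} → List A → ℕ → List (List A)
seqs xs zero = [] ∷ []
seqs xs (suc d) = concatMap (λ x → map (x ∷_) (seqs xs d)) xs

count : ∀ {n} → Pair n → List (Pair n) → ℕ
count e [] = 0
count e (f ∷ fs) = (if e ==ᴾ f then 1 else 0) ℕ.+ count e fs

covered : ∀ {n} → Fin n → List (Pair n) → Bool
covered v [] = false
covered v ((i , j) ∷ fs) = does (v ≟ i) ∨ does (v ≟ j) ∨ covered v fs

unionSize : ∀ {n} → List (Pair n) → ℕ
unionSize {n} fs = length (filter (λ v → Data.Bool._≟_ (covered v fs) true) (allFin n))

-- ∏_{i=1}^{d} 1/|f_1 ∪ ⋯ ∪ f_i|, with `seen` the reversed prefix so far
weight : ∀ {n} → List (Pair n) → List (Pair n) → ℚ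
weight seen [] = 1ℚ
weight seen (f ∷ fs) = inv (unionSize (f ∷ seen)) ℚ.* weight (f ∷ seen) fs

-- a multiplicity vector α ∈ ℤ≥0^{E'} (values off E' are irrelevant)
Mult : ℕ → Set
Mult n = Pair n → ℕ

total : ∀ {n} → Mult n → ℕ
total {n} α = sumℕ (map α (edges n))

matches : ∀ {n} → Mult n → List (Pair n) → Bool
matches {n} α fs = foldr (λ e b → does (count e fs ℕ.≟ α e) ∧ b) true (edges n)

b : ∀ {n} → Mult n → ℚ
b {n} α = sumℚ (map (weight []) (filter (λ fs → Data.Bool._≟_ (matches α fs) true)
                                        (seqs (edges n) (total α))))

addv : ∀ {n} → Mult n → Pair n → Mult n
addv γ e f = γ f ℕ.+ (if f ==ᴾ e then 1 else 0)

Q : ∀ {n} → Mult n → Pair n → Pair n → ℚ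
Q γ i j = if i ==ᴾ j
  then nℚ ((γ i ℕ.+ 1) ℕ.* (γ i ℕ.+ 2)) ℚ.* b (addv (addv γ i) i)
  else nℚ ((γ i ℕ.+ 1) ℕ.* (γ j ℕ.+ 1)) ℚ.* b (addv (addv γ i) j)

ιᴾ : ∀ {m n} → m ≤ n → Pair m → Pair n
ιᴾ p (i , j) = inject≤ i p , inject≤ j p

γ : ∀ {k t} (ẹ : Fin t → Pair k) (n : ℕ) → k ≤ n → Mult n
γ {t = t} ẹ n p e = length (filter (λ i → Data.Bool._≟_ (ιᴾ p (ẹ i) ==ᴾ e) true) (allFin t))

A : ∀ {k t} (ẹ : Fin t → Pair k) (n : ℕ) → k ≤ n → Pair n → Pair n → ℚ
A ẹ n p = Q (γ ẹ n p)

act : ∀ {n} → Permutation′ n → Pair n → Pair n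
act σ (i , j) with σ ⟨$⟩ʳ i | σ ⟨$⟩ʳ j
... | a | c = if does (a Fin.<? c) then (a , c) else (c , a)

-- An injective vertex map τ : [n] → [m] induces an injective map on edges, and it preserves the
-- size of every union f₁ ∪ ⋯ ∪ fᵢ. So if a multiplicity vector α on [m] is the pushforward of β on
-- [n] (it agrees with β along τ and vanishes off the image), every edge sequence counted in b_α
-- lies in the image, and reindexing the sum gives b_α = b_β; the same then holds for the entries
-- of Q. Consistency is the case of the inclusion [n''] ⊆ [n'], invariance the case of σ, which
-- fixes every eᵢ; symmetry holds since b_{γ+v_e+v_f} is symmetric in e and f.

module Submission where

open import Algebra.Bundles using (CommutativeMonoid)
open import Data.Bool using (Bool; true; false; if_then_else_; _∧_; _∨_)
import Data.Bool as Bool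
open import Data.Bool.Properties using (⇔→≡; ∨-assoc; ∨-comm)
open import Data.Empty using (⊥-elim)
open import Data.Fin as Fin using (Fin; inject≤)
open import Data.Fin.Permutation using (Permutation′; _⟨$⟩ʳ_)
open import Data.Fin.Properties as FinP using (_≟_; inject≤-injective)
open import Data.List using (List; []; _∷_; map; foldr; filter; concatMap; allFin; length; _++_)
open import Data.List.Membership.Propositional using (_∈_; _∉_; find)
open import Data.List.Membership.Propositional.Properties
  using (∈-map⁺; ∈-map⁻; ∈-filter⁺; ∈-filter⁻; ∈-concat⁺′; ∈-concatMap⁻; ∈-allFin)
open import Data.List.Membership.Propositional.Properties.WithK using (unique∧set⇒bag)
import Data.List.Membership.DecPropositional as DecMembership
open import Data.List.Properties using (map-∘; filter-≐; filter-none)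
open import Data.List.Relation.Binary.Subset.Propositional.Properties using () renaming (map⁺ to ⊆-map⁺)
open import Data.List.Relation.Binary.BagAndSetEquality using (∼bag⇒↭)
open import Data.List.Relation.Binary.Permutation.Propositional using (_↭_; ↭⇒↭ₛ′)
import Data.List.Relation.Binary.Permutation.Propositional.Properties as ↭
import Data.List.Relation.Binary.Permutation.Setoid.Properties as ↭ₛ
open import Data.List.Relation.Unary.All as All using (All; []; _∷_)
open import Data.List.Relation.Unary.All.Properties using () renaming (map⁺ to All-map⁺)
open import Data.List.Relation.Unary.Any using (Any; here; there)
open import Data.List.Relation.Unary.AllPairs as AllPairs using ([]; _∷_)
import Data.List.Relation.Unary.AllPairs.Properties as AllPairsP
open import Data.List.Relation.Unary.Unique.Propositional using (Unique)
import Data.List.Relation.Unary.Unique.Propositional.Properties as Unique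
open import Data.Nat as ℕ using (ℕ; zero; suc; _≤_; _∸_)
open import Data.Nat.Properties as ℕP using (≤-trans)
open import Data.Product using (_×_; _,_; ∃; proj₁; proj₂; uncurry)
open import Data.Product.Properties using (,-injective)
open import Data.Rational as ℚ using (ℚ; 0ℚ)
import Data.Rational.Properties as ℚP
open import Data.Sum using (_⊎_; inj₁; inj₂)
open import Function using (_∘_; id; const; _⇔_; mk⇔; Equivalence; Injective)
open import Function.Properties.Inverse using (↔⇒↣)
open import Function.Bundles using (Injection)
open import Relation.Binary.Definitions using (DecidableEquality; tri<; tri≈; tri>)
open import Relation.Binary.PropositionalEquality using (_≡_; _≢_; refl; sym; trans; cong; cong₂; subst; module ≡-Reasoning)
open import Relation.Nullary using (¬_; Dec; yes; no; does)
open import Relation.Nullary.Decidable using (map′; _×-dec_; dec-true; dec-false; does-⇔)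
open import Relation.Unary using (Decidable; _≐_)

open import Defs

module ListSum {c ℓ} (M : CommutativeMonoid c ℓ) where

  open CommutativeMonoid M renaming
    (Carrier to C; refl to ≈-refl; sym to ≈-sym; trans to ≈-trans; reflexive to ≈-reflexive)
  open import Relation.Binary.Reasoning.Setoid setoid

  ∑ : {X : Set} → (X → C) → List X → C
  ∑ f xs = foldr _∙_ ε (map f xs)

  ∑-cong : {X : Set} {f g : X → C} (xs : List X) →
    (∀ {x} → x ∈ xs → f x ≈ g x) → ∑ f xs ≈ ∑ g xs
  ∑-cong []       f≈g = ≈-refl
  ∑-cong (x ∷ xs) f≈g = ∙-cong (f≈g (here refl)) (∑-cong xs (f≈g ∘ there))

  ∑-ε : {X : Set} {f : X → C} (xs : List X) → (∀ x → f x ≈ ε) → ∑ f xs ≈ ε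
  ∑-ε []       f≈ε = ≈-refl
  ∑-ε (x ∷ xs) f≈ε = ≈-trans (∙-cong (f≈ε x) (∑-ε xs f≈ε)) (identityˡ ε)

  ∑-map : {X Y : Set} (f : X → C) (g : Y → X) (ys : List Y) → ∑ f (map g ys) ≡ ∑ (f ∘ g) ys
  ∑-map f g ys = cong (foldr _∙_ ε) (sym (map-∘ ys))

  ∑-++ : {X : Set} (f : X → C) (xs ys : List X) → ∑ f (xs ++ ys) ≈ ∑ f xs ∙ ∑ f ys
  ∑-++ f []       ys = ≈-sym (identityˡ _)
  ∑-++ f (x ∷ xs) ys = ≈-trans (∙-congˡ (∑-++ f xs ys)) (≈-sym (assoc _ _ _))

  ∑-concatMap : {X Y : Set} (f : X → C) (g : Y → List X) (ys : List Y) →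
    ∑ f (concatMap g ys) ≈ ∑ (λ y → ∑ f (g y)) ys
  ∑-concatMap f g []       = ≈-refl
  ∑-concatMap f g (y ∷ ys) = ≈-trans (∑-++ f (g y) (concatMap g ys)) (∙-congˡ (∑-concatMap f g ys))

  ∑-↭ : {X : Set} (f : X → C) {xs ys : List X} → xs ↭ ys → ∑ f xs ≈ ∑ f ys
  ∑-↭ f xs↭ys = ↭ₛ.foldr-commMonoid setoid isCommutativeMonoid (↭⇒↭ₛ′ isEquivalence (↭.map⁺ f xs↭ys))

  ∑-filter : {X : Set} {P : X → Set} (P? : Decidable P) {f : X → C} (xs : List X) →
    (∀ {x} → x ∈ xs → ¬ P x → f x ≈ ε) → ∑ f (filter P? xs) ≈ ∑ f xs
  ∑-filter P? []       _ = ≈-refl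
  ∑-filter P? {f} (x ∷ xs) f≈ε with P? x
  ... | yes _  = ∙-congˡ (∑-filter P? xs (f≈ε ∘ there))
  ... | no ¬px = begin
    ∑ f (filter P? xs)  ≈⟨ ∑-filter P? xs (f≈ε ∘ there) ⟩
    ∑ f xs              ≈⟨ identityˡ _ ⟨
    ε ∙ ∑ f xs          ≈⟨ ∙-congʳ (f≈ε (here refl) ¬px) ⟨
    ∑ f (x ∷ xs)        ∎

  ∑-filter-if : {X : Set} (p : X → Bool) (f : X → C) (xs : List X) →
    ∑ f (filter (λ x → p x Bool.≟ true) xs) ≈ ∑ (λ x → if p x then f x else ε) xs
  ∑-filter-if p f []       = ≈-refl
  ∑-filter-if p f (x ∷ xs) with p x
  ... | true  = ∙-congˡ (∑-filter-if p f xs)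
  ... | false = ≈-trans (∑-filter-if p f xs) (≈-sym (identityˡ _))

  ∑-seqs-suc : {X : Set} (G : List X → C) (xs : List X) (d : ℕ) →
    ∑ G (seqs xs (suc d)) ≈ ∑ (λ x → ∑ (G ∘ (x ∷_)) (seqs xs d)) xs
  ∑-seqs-suc G xs d = ≈-trans (∑-concatMap G (λ x → map (x ∷_) (seqs xs d)) xs)
    (∑-cong xs (λ {x} _ → ≈-reflexive (∑-map G (x ∷_) (seqs xs d))))

  module _ {X Y : Set} (_≟X_ : DecidableEquality X) {φ : Y → X} {xs : List X} {ys : List Y}
    (xs-unique : Unique xs) (ys-unique : Unique ys)
    (φ-injective : ∀ {y y′} → y ∈ ys → y′ ∈ ys → φ y ≡ φ y′ → y ≡ y′)
    (φ-into : ∀ {y} → y ∈ ys → φ y ∈ xs) where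

    open DecMembership _≟X_ using (_∈?_)

    private
      map-unique : ∀ {zs} → (∀ {z} → z ∈ zs → z ∈ ys) → Unique zs → Unique (map φ zs)
      map-unique zs⊆ys []                 = []
      map-unique zs⊆ys (z∉zs ∷ zs-unique) =
        All-map⁺ (All.tabulate (λ z′∈ → All.lookup z∉zs z′∈ ∘ φ-injective (zs⊆ys (here refl)) (zs⊆ys (there z′∈))))
          ∷ map-unique (zs⊆ys ∘ there) zs-unique

    -- Summing over xs only sees the image of φ; there the two lists agree as sets, hence as bags.
    ∑-reindex : (f : X → C) → (∀ {x} → x ∈ xs → x ∉ map φ ys → f x ≈ ε) → ∑ f xs ≈ ∑ (f ∘ φ) ys
    ∑-reindex f f≈ε = begin
      ∑ f xs                        ≈⟨ ∑-filter (_∈? map φ ys) xs f≈ε ⟨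
      ∑ f (filter (_∈? map φ ys) xs) ≈⟨ ∑-↭ f (∼bag⇒↭ (unique∧set⇒bag (Unique.filter⁺ (_∈? map φ ys) xs-unique)
                                                                   (map-unique id ys-unique) same-elements)) ⟩
      ∑ f (map φ ys)                ≡⟨ ∑-map f φ ys ⟩
      ∑ (f ∘ φ) ys                  ∎
      where
        same-elements : ∀ {x} → x ∈ filter (_∈? map φ ys) xs ⇔ x ∈ map φ ys
        same-elements = mk⇔ (proj₂ ∘ ∈-filter⁻ (_∈? map φ ys) {xs = xs}) λ x∈image →
          let y , y∈ys , x≡φy = ∈-map⁻ φ x∈image
          in ∈-filter⁺ (_∈? map φ ys) (subst (_∈ xs) (sym x≡φy) (φ-into y∈ys)) x∈image

    ∑-seqs-reindex : (d : ℕ) (G : List X → C) →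
      (∀ {fs} → Any (λ x → x ∈ xs × x ∉ map φ ys) fs → G fs ≈ ε) →
      ∑ G (seqs xs d) ≈ ∑ (G ∘ map φ) (seqs ys d)
    ∑-seqs-reindex zero    G G≈ε = ≈-refl
    ∑-seqs-reindex (suc d) G G≈ε = begin
      ∑ G (seqs xs (suc d))                            ≈⟨ ∑-seqs-suc G xs d ⟩
      ∑ (λ x → ∑ (G ∘ (x ∷_)) (seqs xs d)) xs         ≈⟨ ∑-reindex _ (λ x∈xs x∉image →
                                                            ∑-ε (seqs xs d) (λ _ → G≈ε (here (x∈xs , x∉image)))) ⟩
      ∑ (λ y → ∑ (G ∘ (φ y ∷_)) (seqs xs d)) ys       ≈⟨ ∑-cong ys (λ {y} _ →
                                                            ∑-seqs-reindex d (G ∘ (φ y ∷_)) (G≈ε ∘ there)) ⟩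
      ∑ (λ y → ∑ (G ∘ map φ ∘ (y ∷_)) (seqs ys d)) ys ≈⟨ ∑-seqs-suc (G ∘ map φ) ys d ⟨
      ∑ (G ∘ map φ) (seqs ys (suc d))                  ∎

∈-seqs⁻ : {X : Set} (xs : List X) (d : ℕ) {fs : List X} → fs ∈ seqs xs d → All (_∈ xs) fs
∈-seqs⁻ xs zero    (here refl) = []
∈-seqs⁻ xs (suc d) fs∈        with find (∈-concatMap⁻ (λ x → map (x ∷_) (seqs xs d)) {xs = xs} fs∈)
... | x , x∈xs , fs∈x∷ with ∈-map⁻ (x ∷_) fs∈x∷
... | gs , gs∈ , refl = x∈xs ∷ ∈-seqs⁻ xs d gs∈

module ∑ℕ = ListSum ℕP.+-0-commutativeMonoid
module ∑ℚ = ListSum ℚP.+-0-commutativeMonoid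

indicator : Bool → ℕ
indicator t = if t then 1 else 0

length-filter-true : {X : Set} (p : X → Bool) (xs : List X) →
  length (filter (λ x → p x Bool.≟ true) xs) ≡ ∑ℕ.∑ (indicator ∘ p) xs
length-filter-true p []       = refl
length-filter-true p (x ∷ xs) with p x
... | true  = cong suc (length-filter-true p xs)
... | false = length-filter-true p xs

all-does : {X : Set} {P : X → Set} (P? : Decidable P) (xs : List X) →
  foldr (λ x r → does (P? x) ∧ r) true xs ≡ true ⇔ All P xs
all-does P? []       = mk⇔ (const []) (const refl)
all-does P? (x ∷ xs) with P? x
... | yes px = mk⇔ (λ r → px ∷ Equivalence.to (all-does P? xs) r)
                   (λ { (_ ∷ rest) → Equivalence.from (all-does P? xs) rest })
... | no ¬px = mk⇔ (λ ()) (λ { (px ∷ _) → ⊥-elim (¬px px) })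

-- Chosen so that x ==ᴾ y is definitionally does (x ≟ᴾ y).
_≟ᴾ_ : ∀ {n} → DecidableEquality (Pair n)
(i , j) ≟ᴾ (k , l) = map′ (uncurry (cong₂ _,_)) ,-injective ((i ≟ k) ×-dec (j ≟ l))

==ᴾ-refl : ∀ {n} (x : Pair n) → (x ==ᴾ x) ≡ true
==ᴾ-refl x = dec-true (x ≟ᴾ x) refl

==ᴾ-false : ∀ {n} {x y : Pair n} → x ≢ y → (x ==ᴾ y) ≡ false
==ᴾ-false {x = x} {y} = dec-false (x ≟ᴾ y)

==ᴾ-true : ∀ {n} {x y : Pair n} → (x ==ᴾ y) ≡ true → x ≡ y
==ᴾ-true {x = x} {y} = from-does (x ≟ᴾ y)
  where
    from-does : (x≟y : Dec (x ≡ y)) → does x≟y ≡ true → x ≡ y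
    from-does (yes x≡y) _ = x≡y

count-∉ : ∀ {n} {h : Pair n} (fs : List (Pair n)) → h ∉ fs → count h fs ≡ 0
count-∉ []       _   = refl
count-∉ (f ∷ fs) h∉ = cong₂ ℕ._+_ (cong indicator (==ᴾ-false (h∉ ∘ here))) (count-∉ fs (h∉ ∘ there))

count-∈ : ∀ {n} {h : Pair n} {fs : List (Pair n)} → h ∈ fs → count h fs ≢ 0
count-∈ {h = h} (here refl) rewrite ==ᴾ-refl h = λ ()
count-∈ {h = h} {f ∷ _} (there h∈) = count-∈ h∈ ∘ ℕP.m+n≡0⇒n≡0 (indicator (h ==ᴾ f))

matches-⇔ : ∀ {n} (α : Mult n) (fs : List (Pair n)) →
  matches α fs ≡ true ⇔ All (λ e → count e fs ≡ α e) (edges n)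
matches-⇔ {n} α fs = all-does (λ e → count e fs ℕ.≟ α e) (edges n)

row : ∀ {n} → Fin n → List (Pair n)
row {n} i = map (λ j → (i , j)) (filter (λ j → i Fin.<? j) (allFin n))

∈-edges⁺ : ∀ {n} {x : Pair n} → IsEdge x → x ∈ edges n
∈-edges⁺ {n} {i , j} i<j =
  ∈-concat⁺′ (∈-map⁺ (i ,_) (∈-filter⁺ (i Fin.<?_) (∈-allFin j) i<j)) (∈-map⁺ row (∈-allFin i))

∈-edges⁻ : ∀ {n} {x : Pair n} → x ∈ edges n → IsEdge x
∈-edges⁻ {n} x∈ with find (∈-concatMap⁻ row {xs = allFin n} x∈)
... | i , _ , x∈row with ∈-map⁻ (i ,_) x∈row
... | j , j∈ , refl = proj₂ (∈-filter⁻ (i Fin.<?_) {xs = allFin n} j∈)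

edges-unique : ∀ n → Unique (edges n)
edges-unique n = Unique.concat⁺ (All.tabulate row-unique)
                   (AllPairsP.map⁺ (AllPairs.map rows-disjoint (Unique.allFin⁺ n)))
  where
    row-unique : ∀ {xs} → xs ∈ map row (allFin n) → Unique xs
    row-unique xs∈ with ∈-map⁻ row xs∈
    ... | i , _ , refl = Unique.map⁺ (cong proj₂) (Unique.filter⁺ (i Fin.<?_) (Unique.allFin⁺ n))

    first-∈row : ∀ {i x} → x ∈ row i → proj₁ x ≡ i
    first-∈row {i} x∈ with ∈-map⁻ (i ,_) x∈
    ... | _ , _ , refl = refl

    rows-disjoint : ∀ {i i′} → i ≢ i′ → ∀ {x} → ¬ (x ∈ row i × x ∈ row i′)
    rows-disjoint i≢i′ (x∈ , x∈′) = i≢i′ (trans (sym (first-∈row x∈)) (first-∈row x∈′))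

orient : ∀ {n} → Fin n → Fin n → Pair n
orient a c = if does (a Fin.<? c) then (a , c) else (c , a)

-- act σ is definitionally mapᴾ (σ ⟨$⟩ʳ_).
mapᴾ : ∀ {n m} → (Fin n → Fin m) → Pair n → Pair m
mapᴾ τ (i , j) = orient (τ i) (τ j)

orient-< : ∀ {n} {a c : Fin n} → a Fin.< c → orient a c ≡ (a , c)
orient-< {a = a} {c} a<c = cong (λ t → if t then (a , c) else (c , a)) (dec-true (a Fin.<? c) a<c)

orient-> : ∀ {n} {a c : Fin n} → c Fin.< a → orient a c ≡ (c , a)
orient-> {a = a} {c} c<a = cong (λ t → if t then (a , c) else (c , a)) (dec-false (a Fin.<? c) (FinP.<-asym c<a))

orient-cases : ∀ {n} (a c : Fin n) → orient a c ≡ (a , c) ⊎ orient a c ≡ (c , a)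
orient-cases a c with does (a Fin.<? c)
... | true  = inj₁ refl
... | false = inj₂ refl

orient-edge : ∀ {n} {a c : Fin n} → a ≢ c → IsEdge (orient a c)
orient-edge {a = a} {c} a≢c with FinP.<-cmp a c
... | tri< a<c _ _ = subst IsEdge (sym (orient-< a<c)) a<c
... | tri≈ _ a≡c _ = ⊥-elim (a≢c a≡c)
... | tri> _ _ c<a = subst IsEdge (sym (orient-> c<a)) c<a

matchedWeight : ∀ {n} → Mult n → List (Pair n) → ℚ
matchedWeight α fs = if matches α fs then weight [] fs else 0ℚ

b-as-∑ : ∀ {n} (α : Mult n) → b α ≡ ∑ℚ.∑ (matchedWeight α) (seqs (edges n) (total α))
b-as-∑ {n} α = ∑ℚ.∑-filter-if (matches α) (weight []) (seqs (edges n) (total α))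

-- γ ẹ n p is definitionally multiplicity (ιᴾ p ∘ ẹ).
multiplicity : ∀ {t n} → (Fin t → Pair n) → Mult n
multiplicity {t} x e = length (filter (λ i → (x i ==ᴾ e) Bool.≟ true) (allFin t))

record Pushforward {n m} (τ : Fin n → Fin m) (β : Mult n) (α : Mult m) : Set where
  field
    on-image  : ∀ {g} → g ∈ edges n → α (mapᴾ τ g) ≡ β g
    off-image : ∀ {h} → h ∈ edges m → h ∉ map (mapᴾ τ) (edges n) → α h ≡ 0

module EdgeMap {n m} (τ : Fin n → Fin m) (τ-injective : Injective _≡_ _≡_ τ) where

  mapᴾ-∈ : ∀ {x} → x ∈ edges n → mapᴾ τ x ∈ edges m
  mapᴾ-∈ {i , j} x∈ = ∈-edges⁺ (orient-edge (λ τi≡τj → FinP.<-irrefl (τ-injective τi≡τj) (∈-edges⁻ x∈)))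

  mapᴾ-injective : ∀ {x y} → x ∈ edges n → y ∈ edges n → mapᴾ τ x ≡ mapᴾ τ y → x ≡ y
  mapᴾ-injective {i , j} {k , l} x∈ y∈ eq
    with orient (τ i) (τ j) | orient-cases (τ i) (τ j) | orient (τ k) (τ l) | orient-cases (τ k) (τ l)
  ... | _ | inj₁ refl | _ | inj₁ refl = cong₂ _,_ (τ-injective (cong proj₁ eq)) (τ-injective (cong proj₂ eq))
  ... | _ | inj₂ refl | _ | inj₂ refl = cong₂ _,_ (τ-injective (cong proj₂ eq)) (τ-injective (cong proj₁ eq))
  ... | _ | inj₁ refl | _ | inj₂ refl
    with refl ← τ-injective (cong proj₁ eq) | refl ← τ-injective (cong proj₂ eq)
    = ⊥-elim (FinP.<-asym (∈-edges⁻ x∈) (∈-edges⁻ y∈))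
  ... | _ | inj₂ refl | _ | inj₁ refl
    with refl ← τ-injective (cong proj₁ eq) | refl ← τ-injective (cong proj₂ eq)
    = ⊥-elim (FinP.<-asym (∈-edges⁻ x∈) (∈-edges⁻ y∈))

  ==ᴾ-mapᴾ : ∀ {x y} → x ∈ edges n → y ∈ edges n → (mapᴾ τ x ==ᴾ mapᴾ τ y) ≡ (x ==ᴾ y)
  ==ᴾ-mapᴾ {x} {y} x∈ y∈ = does-⇔ (mk⇔ (mapᴾ-injective x∈ y∈) (cong (mapᴾ τ))) (mapᴾ τ x ≟ᴾ mapᴾ τ y) (x ≟ᴾ y)

  private
    ≟-τ : ∀ a c → does (τ a ≟ τ c) ≡ does (a ≟ c)
    ≟-τ a c = does-⇔ (mk⇔ τ-injective (cong τ)) (τ a ≟ τ c) (a ≟ c)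

    ≟-outside : ∀ {w} → w ∉ map τ (allFin n) → ∀ a → does (w ≟ τ a) ≡ false
    ≟-outside w∉ a = dec-false (_ ≟ τ a) (λ w≡τa → w∉ (subst (_∈ _) (sym w≡τa) (∈-map⁺ τ (∈-allFin a))))

    ∨-swap : ∀ s t u → (s ∨ t ∨ u) ≡ (t ∨ s ∨ u)
    ∨-swap s t u = trans (sym (∨-assoc s t u)) (trans (cong (_∨ u) (∨-comm s t)) (∨-assoc t s u))

  covered-mapᴾ : ∀ v fs → covered (τ v) (map (mapᴾ τ) fs) ≡ covered v fs
  covered-mapᴾ v []             = refl
  covered-mapᴾ v ((i , j) ∷ fs) with orient (τ i) (τ j) | orient-cases (τ i) (τ j)
  ... | _ | inj₁ refl rewrite ≟-τ v i | ≟-τ v j | covered-mapᴾ v fs = refl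
  ... | _ | inj₂ refl rewrite ≟-τ v i | ≟-τ v j | covered-mapᴾ v fs = ∨-swap (does (v ≟ j)) (does (v ≟ i)) _

  covered-outside : ∀ {w} → w ∉ map τ (allFin n) → ∀ fs → covered w (map (mapᴾ τ) fs) ≡ false
  covered-outside w∉ []             = refl
  covered-outside w∉ ((i , j) ∷ fs) with orient (τ i) (τ j) | orient-cases (τ i) (τ j)
  ... | _ | inj₁ refl rewrite ≟-outside w∉ i | ≟-outside w∉ j = covered-outside w∉ fs
  ... | _ | inj₂ refl rewrite ≟-outside w∉ i | ≟-outside w∉ j = covered-outside w∉ fs

  unionSize-mapᴾ : ∀ fs → unionSize (map (mapᴾ τ) fs) ≡ unionSize fs
  unionSize-mapᴾ fs = begin
    unionSize (map (mapᴾ τ) fs)                    ≡⟨ length-filter-true covered-image (allFin m) ⟩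
    ∑ℕ.∑ (indicator ∘ covered-image) (allFin m)     ≡⟨ ∑ℕ.∑-reindex _≟_ (Unique.allFin⁺ m) (Unique.allFin⁺ n)
                                                         (λ _ _ → τ-injective) (λ _ → ∈-allFin _) (indicator ∘ covered-image)
                                                         (λ _ w∉ → cong indicator (covered-outside w∉ fs)) ⟩
    ∑ℕ.∑ (indicator ∘ covered-image ∘ τ) (allFin n) ≡⟨ ∑ℕ.∑-cong (allFin n) (λ {v} _ → cong indicator (covered-mapᴾ v fs)) ⟩
    ∑ℕ.∑ (indicator ∘ (λ v → covered v fs)) (allFin n) ≡⟨ length-filter-true (λ v → covered v fs) (allFin n) ⟨
    unionSize fs                                    ∎
    where
      open ≡-Reasoning
      covered-image : Fin m → Bool
      covered-image w = covered w (map (mapᴾ τ) fs)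

  weight-mapᴾ : ∀ seen fs → weight (map (mapᴾ τ) seen) (map (mapᴾ τ) fs) ≡ weight seen fs
  weight-mapᴾ seen []       = refl
  weight-mapᴾ seen (f ∷ fs) = cong₂ ℚ._*_ (cong inv (unionSize-mapᴾ (f ∷ seen))) (weight-mapᴾ (f ∷ seen) fs)

  count-mapᴾ : ∀ {g} fs → g ∈ edges n → All (_∈ edges n) fs → count (mapᴾ τ g) (map (mapᴾ τ) fs) ≡ count g fs
  count-mapᴾ []       _  []           = refl
  count-mapᴾ (f ∷ fs) g∈ (f∈ ∷ fs⊆) = cong₂ ℕ._+_ (cong indicator (==ᴾ-mapᴾ g∈ f∈)) (count-mapᴾ fs g∈ fs⊆)

  module _ {β : Mult n} {α : Mult m} (push : Pushforward τ β α) where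

    open Pushforward push
    open DecMembership (_≟ᴾ_ {m}) using (_∈?_)

    total-pushforward : total α ≡ total β
    total-pushforward =
      trans (∑ℕ.∑-reindex _≟ᴾ_ (edges-unique m) (edges-unique n) mapᴾ-injective mapᴾ-∈ α off-image)
            (∑ℕ.∑-cong (edges n) on-image)

    matches-pushforward : ∀ {fs} → All (_∈ edges n) fs → matches α (map (mapᴾ τ) fs) ≡ matches β fs
    matches-pushforward {fs} fs⊆ = ⇔→≡ (mk⇔ to from)
      where
        to : matches α (map (mapᴾ τ) fs) ≡ true → matches β fs ≡ true
        to matched = Equivalence.from (matches-⇔ β fs) (All.tabulate λ {g} g∈ → begin
          count g fs                             ≡⟨ count-mapᴾ fs g∈ fs⊆ ⟨
          count (mapᴾ τ g) (map (mapᴾ τ) fs)     ≡⟨ All.lookup (Equivalence.to (matches-⇔ α (map (mapᴾ τ) fs)) matched)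
                                                      (mapᴾ-∈ g∈) ⟩
          α (mapᴾ τ g)                           ≡⟨ on-image g∈ ⟩
          β g                                    ∎)
          where open ≡-Reasoning

        from : matches β fs ≡ true → matches α (map (mapᴾ τ) fs) ≡ true
        from matched = Equivalence.from (matches-⇔ α (map (mapᴾ τ) fs)) (All.tabulate counted)
          where
            counted : ∀ {h} → h ∈ edges m → count h (map (mapᴾ τ) fs) ≡ α h
            counted {h} h∈ with h ∈? map (mapᴾ τ) (edges n)
            ... | no h∉ = trans (count-∉ _ (h∉ ∘ ⊆-map⁺ (mapᴾ τ) (All.lookup fs⊆))) (sym (off-image h∈ h∉))
            ... | yes h∈image with ∈-map⁻ (mapᴾ τ) h∈image
            ...   | g , g∈ , refl =
              trans (count-mapᴾ fs g∈ fs⊆)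
                    (trans (All.lookup (Equivalence.to (matches-⇔ β fs) matched) g∈) (sym (on-image g∈)))

    matchedWeight-pushforward : ∀ {fs} → All (_∈ edges n) fs →
      matchedWeight α (map (mapᴾ τ) fs) ≡ matchedWeight β fs
    matchedWeight-pushforward {fs} fs⊆ rewrite matches-pushforward fs⊆ =
      cong (λ w → if matches β fs then w else 0ℚ) (weight-mapᴾ [] fs)

    matchedWeight-off-image : ∀ {fs} → Any (λ h → h ∈ edges m × h ∉ map (mapᴾ τ) (edges n)) fs →
      matchedWeight α fs ≡ 0ℚ
    matchedWeight-off-image {fs} off with matches α fs in matched
    ... | false = refl
    ... | true  = let h , h∈fs , h∈ , h∉ = find off in
      ⊥-elim (count-∈ h∈fs (trans (All.lookup (Equivalence.to (matches-⇔ α fs) matched) h∈) (off-image h∈ h∉)))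

    b-pushforward : b α ≡ b β
    b-pushforward = begin
      b α                                                              ≡⟨ b-as-∑ α ⟩
      ∑ℚ.∑ (matchedWeight α) (seqs (edges m) (total α))                ≡⟨ cong (∑ℚ.∑ (matchedWeight α) ∘ seqs (edges m))
                                                                            total-pushforward ⟩
      ∑ℚ.∑ (matchedWeight α) (seqs (edges m) (total β))                ≡⟨ ∑ℚ.∑-seqs-reindex _≟ᴾ_ (edges-unique m) (edges-unique n)
                                                                            mapᴾ-injective mapᴾ-∈ (total β) (matchedWeight α)
                                                                            matchedWeight-off-image ⟩
      ∑ℚ.∑ (matchedWeight α ∘ map (mapᴾ τ)) (seqs (edges n) (total β)) ≡⟨ ∑ℚ.∑-cong (seqs (edges n) (total β))
                                                                            (matchedWeight-pushforward ∘ ∈-seqs⁻ (edges n) (total β)) ⟩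
      ∑ℚ.∑ (matchedWeight β) (seqs (edges n) (total β))                ≡⟨ b-as-∑ β ⟨
      b β                                                              ∎
      where open ≡-Reasoning

  addv-pushforward : ∀ {β α e} → Pushforward τ β α → e ∈ edges n → Pushforward τ (addv β e) (addv α (mapᴾ τ e))
  addv-pushforward push e∈ = record
    { on-image  = λ g∈ → cong₂ ℕ._+_ (on-image g∈) (cong indicator (==ᴾ-mapᴾ g∈ e∈))
    ; off-image = λ h∈ h∉ → cong₂ ℕ._+_ (off-image h∈ h∉)
        (cong indicator (==ᴾ-false λ h≡τe → h∉ (subst (_∈ _) (sym h≡τe) (∈-map⁺ (mapᴾ τ) e∈))))
    }
    where open Pushforward push

  Q-pushforward : ∀ {γ′ γ e f} → Pushforward τ γ γ′ → e ∈ edges n → f ∈ edges n →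
    Q γ′ (mapᴾ τ e) (mapᴾ τ f) ≡ Q γ e f
  Q-pushforward push e∈ f∈
    rewrite ==ᴾ-mapᴾ e∈ f∈ | Pushforward.on-image push e∈ | Pushforward.on-image push f∈
          | b-pushforward (addv-pushforward (addv-pushforward push e∈) e∈)
          | b-pushforward (addv-pushforward (addv-pushforward push e∈) f∈) = refl

  multiplicity-pushforward : ∀ {t} (x : Fin t → Pair n) (y : Fin t → Pair m) →
    (∀ i → x i ∈ edges n) → (∀ i → y i ≡ mapᴾ τ (x i)) →
    Pushforward τ (multiplicity x) (multiplicity y)
  multiplicity-pushforward {t} x y x∈ y≡τx = record
    { on-image  = λ g∈ → cong length (filter-≐ _ _ (same-test g∈) (allFin t))
    ; off-image = λ {h} _ h∉ → cong length (filter-none (λ i → (y i ==ᴾ h) Bool.≟ true) {xs = allFin t}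
        (All.tabulate λ {i} _ yi==h → h∉ (subst (_∈ map (mapᴾ τ) (edges n))
          (trans (sym (y≡τx i)) (==ᴾ-true yi==h)) (∈-map⁺ (mapᴾ τ) (x∈ i)))))
    }
    where
      same-test : ∀ {g} → g ∈ edges n →
        (λ i → (y i ==ᴾ mapᴾ τ g) ≡ true) ≐ (λ i → (x i ==ᴾ g) ≡ true)
      same-test {g} g∈ = (λ {i} → trans (sym (test i))) , (λ {i} → trans (test i))
        where
          test : ∀ i → (y i ==ᴾ mapᴾ τ g) ≡ (x i ==ᴾ g)
          test i = trans (cong (_==ᴾ mapᴾ τ g) (y≡τx i)) (==ᴾ-mapᴾ (x∈ i) g∈)

b-cong : ∀ {n} {α β : Mult n} → (∀ e → α e ≡ β e) → b α ≡ b β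
b-cong {n} {α} {β} α≗β = EdgeMap.b-pushforward id id push
  where
    mapᴾ-id : ∀ {g} → g ∈ edges n → mapᴾ id g ≡ g
    mapᴾ-id g∈ = orient-< (∈-edges⁻ g∈)

    push : Pushforward id β α
    push = record
      { on-image  = λ g∈ → trans (cong α (mapᴾ-id g∈)) (α≗β _)
      ; off-image = λ h∈ h∉ → ⊥-elim (h∉ (subst (_∈ _) (mapᴾ-id h∈) (∈-map⁺ (mapᴾ id) h∈)))
      }

addv-comm : ∀ {n} (γ : Mult n) e f x → addv (addv γ e) f x ≡ addv (addv γ f) e x
addv-comm γ e f x = begin
  γ x ℕ.+ indicator (x ==ᴾ e) ℕ.+ indicator (x ==ᴾ f)   ≡⟨ ℕP.+-assoc (γ x) _ _ ⟩
  γ x ℕ.+ (indicator (x ==ᴾ e) ℕ.+ indicator (x ==ᴾ f)) ≡⟨ cong (γ x ℕ.+_) (ℕP.+-comm (indicator (x ==ᴾ e)) _) ⟩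
  γ x ℕ.+ (indicator (x ==ᴾ f) ℕ.+ indicator (x ==ᴾ e)) ≡⟨ ℕP.+-assoc (γ x) _ _ ⟨
  γ x ℕ.+ indicator (x ==ᴾ f) ℕ.+ indicator (x ==ᴾ e)   ∎
  where open ≡-Reasoning

Q-sym : ∀ {n} (γ : Mult n) e f → Q γ e f ≡ Q γ f e
Q-sym γ e f with e ≟ᴾ f
... | yes refl = refl
... | no  e≢f rewrite ==ᴾ-false e≢f | ==ᴾ-false (e≢f ∘ sym) =
  cong₂ ℚ._*_ (cong nℚ (ℕP.*-comm (γ e ℕ.+ 1) (γ f ℕ.+ 1))) (b-cong (addv-comm γ e f))

ιᴾ-edge : ∀ {m n} (q : m ≤ n) {x : Pair m} → IsEdge x → IsEdge (ιᴾ q x)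
ιᴾ-edge q {i , j} i<j rewrite FinP.toℕ-inject≤ i q | FinP.toℕ-inject≤ j q = i<j

ιᴾ-trans : ∀ {k m n} (p : k ≤ m) (q : m ≤ n) (x : Pair k) → ιᴾ (≤-trans p q) x ≡ ιᴾ q (ιᴾ p x)
ιᴾ-trans p q (i , j) = cong₂ _,_ (sym (FinP.inject≤-trans i p q)) (sym (FinP.inject≤-trans j p q))

mapᴾ-inject≤ : ∀ {m n} (q : m ≤ n) {x : Pair m} → IsEdge x → mapᴾ (λ i → inject≤ i q) x ≡ ιᴾ q x
mapᴾ-inject≤ q x-edge = orient-< (ιᴾ-edge q x-edge)

mapᴾ-fixed : ∀ {n} {τ : Fin n → Fin n} {x : Pair n} →
  τ (proj₁ x) ≡ proj₁ x → τ (proj₂ x) ≡ proj₂ x → IsEdge x → mapᴾ τ x ≡ x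
mapᴾ-fixed τi≡i τj≡j x-edge = trans (cong₂ orient τi≡i τj≡j) (orient-< x-edge)

module _ {k t} (ẹ : Fin t → Pair k) (ẹ-edges : ∀ i → IsEdge (ẹ i)) where

  private
    ẹ-∈ : ∀ {n} (p : k ≤ n) i → ιᴾ p (ẹ i) ∈ edges n
    ẹ-∈ p i = ∈-edges⁺ (ιᴾ-edge p (ẹ-edges i))

  A-ιᴾ : ∀ {n″ n′} (p″ : k ≤ n″) (q : n″ ≤ n′) {e f} → IsEdge e → IsEdge f →
    A ẹ n″ p″ e f ≡ A ẹ n′ (≤-trans p″ q) (ιᴾ q e) (ιᴾ q f)
  A-ιᴾ {n″} {n′} p″ q {e} {f} e-edge f-edge = begin
    A ẹ n″ p″ e f                           ≡⟨ Q-pushforward push (∈-edges⁺ e-edge) (∈-edges⁺ f-edge) ⟨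
    A ẹ n′ p′ (mapᴾ ι e) (mapᴾ ι f)         ≡⟨ cong₂ (A ẹ n′ p′) (mapᴾ-inject≤ q e-edge) (mapᴾ-inject≤ q f-edge) ⟩
    A ẹ n′ p′ (ιᴾ q e) (ιᴾ q f)             ∎
    where
      open ≡-Reasoning
      ι = λ i → inject≤ i q
      p′ = ≤-trans p″ q
      open EdgeMap ι (inject≤-injective q q _ _)
      push = multiplicity-pushforward (ιᴾ p″ ∘ ẹ) (ιᴾ p′ ∘ ẹ) (ẹ-∈ p″)
        (λ i → trans (ιᴾ-trans p″ q (ẹ i)) (sym (mapᴾ-inject≤ q (ιᴾ-edge p″ (ẹ-edges i)))))

  A-act : ∀ {n} (p : k ≤ n) (σ : Permutation′ n) → (∀ v → σ ⟨$⟩ʳ inject≤ v p ≡ inject≤ v p) →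
    ∀ {e f} → IsEdge e → IsEdge f → A ẹ n p (act σ e) (act σ f) ≡ A ẹ n p e f
  A-act p σ σ-fixes e-edge f-edge = Q-pushforward push (∈-edges⁺ e-edge) (∈-edges⁺ f-edge)
    where
      open EdgeMap (σ ⟨$⟩ʳ_) (Injection.injective (↔⇒↣ σ))
      push = multiplicity-pushforward (ιᴾ p ∘ ẹ) (ιᴾ p ∘ ẹ) (ẹ-∈ p)
        (λ i → sym (mapᴾ-fixed {τ = σ ⟨$⟩ʳ_} (σ-fixes _) (σ-fixes _) (ιᴾ-edge p (ẹ-edges i))))

proposition2p2 :
    (d k : ℕ) → 2 ≤ d →
    (ẹ : Fin (d ∸ 2) → Pair k) →
    (∀ i → IsEdge (ẹ i)) →
    (∀ (v : Fin k) → ∃ λ i → v ≡ proj₁ (ẹ i) ⊎ v ≡ proj₂ (ẹ i)) →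
    -- (i) symmetry
    ((n : ℕ) (p : k ≤ n) (e f : Pair n) → IsEdge e → IsEdge f →
      A ẹ n p e f ≡ A ẹ n p f e)
    ×
    -- (ii) consistency along k ≤ n'' ≤ n'
    ((n'' n' : ℕ) (p'' : k ≤ n'') (q : n'' ≤ n') (e f : Pair n'') → IsEdge e → IsEdge f →
      A ẹ n'' p'' e f ≡ A ẹ n' (≤-trans p'' q) (ιᴾ q e) (ιᴾ q f))
    ×
    -- (iii) invariance under permutations of [n'] fixing [k] pointwise
    ((n : ℕ) (p : k ≤ n) (σ : Permutation′ n) →
      (∀ (v : Fin k) → σ ⟨$⟩ʳ inject≤ v p ≡ inject≤ v p) →
      (e f : Pair n) → IsEdge e → IsEdge f →
      A ẹ n p (act σ e) (act σ f) ≡ A ẹ n p e f)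
proposition2p2 d k _ ẹ ẹ-edges _ =
    (λ n p e f _ _ → Q-sym (γ ẹ n p) e f)
  , (λ n″ n′ p″ q e f → A-ιᴾ ẹ ẹ-edges p″ q)
  , (λ n p σ σ-fixes e f → A-act ẹ ẹ-edges p σ σ-fixes)
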